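{- Let $\mathcal{A}$ be a DMF-algebra, $\overline{v}$ an isotone partial valuation on $\mathcal{A}$, and $e,h\in\nabla=\{x\in A: n\le x\}$ with $\overline{v}(e)_0\neq0$ and $\overline{v}(h)_0\neq0$. Then $$\overline{v}(h\mid e)=\overline{v}(e\mid h)\cdot\frac{\overline{v}(h)_0}{\overline{v}(e)_0}.$$
   Context: A DMF-algebra is an algebra $(A,\wedge,\vee,\lnot,0,1,n)$ such that $(A,\wedge,\vee,0,1)$ is a bounded distributive lattice, $\lnot\lnot x=x$, $\lnot(x\wedge y)=\lnot x\vee\lnot y$, $x\wedge\lnot x\le y\vee\lnot y$, and $\lnot n=n$. Let $T=\{(x,y)\in[0,1]^2:x+y\le1\}$ with $(x,y)\preccurlyeq(w,z)$ iff $x\le w$ and $z\le y$; pair arithmetic and multiplication by scalars are componentwise; $(x,y)_0=x$, $(x,y)_1=y$; $\sigma(x,y)=(y,x)$. A partial valuation on $\mathcal{A}$ is $\overline{v}:A\to T$ with $\overline{v}(0)=(0,1)$, $\overline{v}(a\vee b)=\overline{v}(a)+\overline{v}(b)-\overline{v}(a\wedge b)$, $\overline{v}(\lnot a)=\sigma(\overline{v}(a))$, $n\le a\Rightarrow(0,0)\preccurlyeq\overline{v}(a)$; it is isotone if $a\le b$ implies $\overline{v}(a)\preccurlyeq\overline{v}(b)$. For an isotone partial valuation $\overline{v}$ and $h$ with $n\le h$ and $\overline{v}(h)_0\neq0$, the conditional partial valuation is $\overline{v}(x\mid h)=\overline{v}\big((x\vee\lnot h)\wedge h\big)\cdot\frac{1}{\overline{v}(h)_0}$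 for $x\in A$. -}

module Defs where

open import Level using (Level; _⊔_) renaming (suc to lsuc)
open import Data.Product using (Σ; ∃; _×_; _,_; proj₁; proj₂)
open import Data.Sum using (_⊎_)
open import Relation.Binary.PropositionalEquality using (_≡_; _≢_)
open import Algebra.Bundles using (CommutativeRing)

-- The real numbers, axiomatised as a complete ordered field
-- (any model of this record is isomorphic to ℝ).

record RealField (c : Level) : Set (lsuc c) where
  infix 4 _≤_
  field
    commRing : CommutativeRing c c
  open CommutativeRing commRing public
  field
    ≈⇒≡   : ∀ {x y} → x ≈ y → x ≡ y
    0≢1   : 0# ≢ 1#
    _⁻¹   : (x : Carrier) → x ≢ 0# → Carrier
    ⁻¹-inverse : ∀ x (p : x ≢ 0#) → x * (x ⁻¹) p ≡ 1#
    _≤_   : Carrier → Carrier → Set c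
    ≤-refl    : ∀ x → x ≤ x
    ≤-trans   : ∀ {x y z} → x ≤ y → y ≤ z → x ≤ z
    ≤-antisym : ∀ {x y} → x ≤ y → y ≤ x → x ≡ y
    ≤-total   : ∀ x y → x ≤ y ⊎ y ≤ x
    +-mono-≤  : ∀ {x y} z → x ≤ y → x + z ≤ y + z
    *-nonneg  : ∀ {x y} → 0# ≤ x → 0# ≤ y → 0# ≤ x * y
    complete  : (P : Carrier → Set c) → (∃ λ x → P x) →
                (∃ λ b → ∀ x → P x → x ≤ b) →
                ∃ λ s → (∀ x → P x → x ≤ s) × (∀ b → (∀ x → P x → x ≤ b) → s ≤ b)

record DMFAlgebra (a : Level) : Set (lsuc a) where
  infixr 6 _∧_
  infixr 5 _∨_
  field
    A   : Set a
    _∧_ : A → A → A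
    _∨_ : A → A → A
    ∼_  : A → A
    ⊥′  : A
    ⊤′  : A
    n   : A
    ∧-assoc : ∀ x y z → (x ∧ y) ∧ z ≡ x ∧ (y ∧ z)
    ∨-assoc : ∀ x y z → (x ∨ y) ∨ z ≡ x ∨ (y ∨ z)
    ∧-comm  : ∀ x y → x ∧ y ≡ y ∧ x
    ∨-comm  : ∀ x y → x ∨ y ≡ y ∨ x
    ∧-absorbs-∨ : ∀ x y → x ∧ (x ∨ y) ≡ x
    ∨-absorbs-∧ : ∀ x y → x ∨ (x ∧ y) ≡ x
    ∧-distrib-∨ : ∀ x y z → x ∧ (y ∨ z) ≡ (x ∧ y) ∨ (x ∧ z)
    ∨-identity  : ∀ x → x ∨ ⊥′ ≡ x
    ∧-identity  : ∀ x → x ∧ ⊤′ ≡ x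
    ¬-involutive : ∀ x → ∼ (∼ x) ≡ x
    ¬-∧          : ∀ x y → ∼ (x ∧ y) ≡ (∼ x) ∨ (∼ y)
    kleene       : ∀ x y → (x ∧ ∼ x) ∧ (y ∨ ∼ y) ≡ x ∧ ∼ x
    ∼n≡n         : ∼ n ≡ n

  _≤_ : A → A → Set a
  x ≤ y = x ∧ y ≡ x

module Valuations {c a : Level} (ℝ : RealField c) (𝒜 : DMFAlgebra a) where
  open RealField ℝ renaming (_≤_ to _≤ᵣ_)
  open DMFAlgebra 𝒜 renaming (_≤_ to _≤ₐ_)

  Pair : Set c
  Pair = Carrier × Carrier

  _⊕_ : Pair → Pair → Pair
  (x , y) ⊕ (w , z) = (x + w , y + z)

  _⊖_ : Pair → Pair → Pair
  (x , y) ⊖ (w , z) = (x - w , y - z)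

  _·_ : Pair → Carrier → Pair
  (x , y) · r = (x * r , y * r)

  _₀ : Pair → Carrier
  _₀ = proj₁

  _₁ : Pair → Carrier
  _₁ = proj₂

  σ : Pair → Pair
  σ (x , y) = (y , x)

  _≼_ : Pair → Pair → Set c
  (x , y) ≼ (w , z) = (x ≤ᵣ w) × (z ≤ᵣ y)

  InT : Pair → Set c
  InT (x , y) = (0# ≤ᵣ x) × (x ≤ᵣ 1#) × (0# ≤ᵣ y) × (y ≤ᵣ 1#) × (x + y ≤ᵣ 1#)

  record IsPartialValuation (v : A → Pair) : Set (a ⊔ c) where
    field
      inT    : ∀ x → InT (v x)
      v-0    : v ⊥′ ≡ (0# , 1#)
      v-∨    : ∀ x y → v (x ∨ y) ≡ (v x ⊕ v y) ⊖ v (x ∧ y)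
      v-¬    : ∀ x → v (∼ x) ≡ σ (v x)
      v-∇    : ∀ x → n ≤ₐ x → (0# , 0#) ≼ v x

  IsIsotone : (A → Pair) → Set (a ⊔ c)
  IsIsotone v = ∀ x y → x ≤ₐ y → v x ≼ v y

  -- conditional partial valuation  v(x | h) = v((x ∨ ¬h) ∧ h) · (1 / v(h)₀)
  cond : (v : A → Pair) (x h : A) → (v h) ₀ ≢ 0# → Pair
  cond v x h p = v ((x ∨ ∼ h) ∧ h) · ((v h ₀) ⁻¹) p

module Submission where

-- For e, h above the fixpoint n, the negation ∼ e lies below n and hence below h,
-- so the conditioning term (h ∨ ∼ e) ∧ e collapses to e ∧ h.  Both conditionals
-- are therefore the same quantity v (e ∧ h), divided by v e ₀ resp. v h ₀, and
-- the identity is a rescaling.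

open import Defs
open import Level using (Level)
open import Data.Product using (_,_)
open import Relation.Binary.PropositionalEquality
  using (_≡_; _≢_; sym; trans; cong; cong₂; module ≡-Reasoning)

module DMFAlgebraProperties {a : Level} (𝒜 : DMFAlgebra a) where
  open DMFAlgebra 𝒜
  open ≡-Reasoning

  ≤-trans : ∀ {x y z} → x ≤ y → y ≤ z → x ≤ z
  ≤-trans {x} {y} {z} x≤y y≤z = begin
    x ∧ z        ≡⟨ cong (_∧ z) (sym x≤y) ⟩
    (x ∧ y) ∧ z  ≡⟨ ∧-assoc x y z ⟩
    x ∧ (y ∧ z)  ≡⟨ cong (x ∧_) y≤z ⟩
    x ∧ y        ≡⟨ x≤y ⟩
    x            ∎

  ≤⇒∨≡ : ∀ {x y} → x ≤ y → x ∨ y ≡ y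
  ≤⇒∨≡ {x} {y} x≤y = begin
    x ∨ y        ≡⟨ cong (_∨ y) (sym x≤y) ⟩
    (x ∧ y) ∨ y  ≡⟨ ∨-comm (x ∧ y) y ⟩
    y ∨ (x ∧ y)  ≡⟨ cong (y ∨_) (∧-comm x y) ⟩
    y ∨ (y ∧ x)  ≡⟨ ∨-absorbs-∧ y x ⟩
    y            ∎

  ∨≡⇒≤ : ∀ {x y} → x ∨ y ≡ y → x ≤ y
  ∨≡⇒≤ {x} {y} x∨y≡y = trans (cong (x ∧_) (sym x∨y≡y)) (∧-absorbs-∨ x y)

  ∼-antitone : ∀ {x y} → x ≤ y → (∼ y) ≤ (∼ x)
  ∼-antitone {x} {y} x≤y = ∨≡⇒≤ (begin
    ∼ y ∨ ∼ x  ≡⟨ sym (¬-∧ y x) ⟩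
    ∼ (y ∧ x)  ≡⟨ cong ∼_ (∧-comm y x) ⟩
    ∼ (x ∧ y)  ≡⟨ cong ∼_ x≤y ⟩
    ∼ x        ∎)

  ∼-below-n : ∀ {x} → n ≤ x → (∼ x) ≤ n
  ∼-below-n {x} n≤x = trans (cong (λ m → ∼ x ∧ m) (sym ∼n≡n)) (∼-antitone n≤x)

  conditioning-∇ : ∀ {e h} → n ≤ e → n ≤ h → (h ∨ ∼ e) ∧ e ≡ e ∧ h
  conditioning-∇ {e} {h} n≤e n≤h = begin
    (h ∨ ∼ e) ∧ e              ≡⟨ ∧-comm (h ∨ ∼ e) e ⟩
    e ∧ (h ∨ ∼ e)              ≡⟨ ∧-distrib-∨ e h (∼ e) ⟩
    (e ∧ h) ∨ (e ∧ ∼ e)        ≡⟨ cong (λ z → (e ∧ h) ∨ (e ∧ z)) (sym ∼e≤h) ⟩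
    (e ∧ h) ∨ (e ∧ (∼ e ∧ h))  ≡⟨ cong ((e ∧ h) ∨_) (e∧∼e∧h≡e∧h∧∼e) ⟩
    (e ∧ h) ∨ ((e ∧ h) ∧ ∼ e)  ≡⟨ ∨-absorbs-∧ (e ∧ h) (∼ e) ⟩
    e ∧ h                      ∎
    where
    ∼e≤h : (∼ e) ≤ h
    ∼e≤h = ≤-trans (∼-below-n n≤e) n≤h

    e∧∼e∧h≡e∧h∧∼e : e ∧ (∼ e ∧ h) ≡ (e ∧ h) ∧ ∼ e
    e∧∼e∧h≡e∧h∧∼e = trans (cong (e ∧_) (∧-comm (∼ e) h)) (sym (∧-assoc e h (∼ e)))

module ConditionalProperties {c a : Level} (ℝ : RealField c) (𝒜 : DMFAlgebra a) where
  open RealField ℝ hiding (_≤_; sym; trans)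
  open DMFAlgebra 𝒜
  open Valuations ℝ 𝒜
  open DMFAlgebraProperties 𝒜
  open ≡-Reasoning

  ·-assoc : ∀ p r s → (p · r) · s ≡ p · (r * s)
  ·-assoc (x , y) r s = cong₂ _,_ (≈⇒≡ (*-assoc x r s)) (≈⇒≡ (*-assoc y r s))

  ⁻¹-cancelˡ : ∀ x (x≢0 : x ≢ 0#) y → (x ⁻¹) x≢0 * (x * y) ≡ y
  ⁻¹-cancelˡ x x≢0 y = begin
    x⁻¹ * (x * y)  ≡⟨ sym (≈⇒≡ (*-assoc x⁻¹ x y)) ⟩
    (x⁻¹ * x) * y  ≡⟨ cong (_* y) (≈⇒≡ (*-comm x⁻¹ x)) ⟩
    (x * x⁻¹) * y  ≡⟨ cong (_* y) (⁻¹-inverse x x≢0) ⟩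
    1# * y         ≡⟨ ≈⇒≡ (*-identityˡ y) ⟩
    y              ∎
    where x⁻¹ = (x ⁻¹) x≢0

  cond-∇ : ∀ (v : A → Pair) {e h} → n ≤ e → n ≤ h → (pe : v e ₀ ≢ 0#) →
           cond v h e pe ≡ v (e ∧ h) · (v e ₀ ⁻¹) pe
  cond-∇ v {e} n≤e n≤h pe = cong (λ x → v x · (v e ₀ ⁻¹) pe) (conditioning-∇ n≤e n≤h)

mainTheorem13 : ∀ {c a : Level} (ℝ : RealField c) (𝒜 : DMFAlgebra a) →
    let open RealField ℝ hiding (_≤_)
        open DMFAlgebra 𝒜
        open Valuations ℝ 𝒜
    in (v : A → Pair) → IsPartialValuation v → IsIsotone v →
       (e h : A) → n ≤ e → n ≤ h →
       (pe : v e ₀ ≢ 0#) (ph : v h ₀ ≢ 0#) →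
       cond v h e pe ≡ cond v e h ph · (v h ₀ * (v e ₀ ⁻¹) pe)
mainTheorem13 ℝ 𝒜 v _ _ e h n≤e n≤h pe ph = begin
  cond v h e pe                        ≡⟨ cond-∇ v n≤e n≤h pe ⟩
  v (e ∧ h) · e⁻¹                      ≡⟨ cong (λ x → v x · e⁻¹) (∧-comm e h) ⟩
  v (h ∧ e) · e⁻¹                      ≡⟨ cong (v (h ∧ e) ·_) (sym (⁻¹-cancelˡ (v h ₀) ph e⁻¹)) ⟩
  v (h ∧ e) · (h⁻¹ * (v h ₀ * e⁻¹))    ≡⟨ sym (·-assoc (v (h ∧ e)) h⁻¹ (v h ₀ * e⁻¹)) ⟩
  (v (h ∧ e) · h⁻¹) · (v h ₀ * e⁻¹)    ≡⟨ cong (_· (v h ₀ * e⁻¹)) (sym (cond-∇ v n≤h n≤e ph)) ⟩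
  cond v e h ph · (v h ₀ * e⁻¹)        ∎
  where
  open RealField ℝ hiding (_≤_; sym; trans)
  open DMFAlgebra 𝒜
  open Valuations ℝ 𝒜
  open ConditionalProperties ℝ 𝒜
  open ≡-Reasoning
  e⁻¹ h⁻¹ : Carrier
  e⁻¹ = (v e ₀ ⁻¹) pe
  h⁻¹ = (v h ₀ ⁻¹) ph
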